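{- Let $M^c_{\min}$ and $M^c_{\max}$ be the canonical pseudo-models of $\mathbf{SC}_{\min}$ and $\mathbf{SC}_{\max}$ respectively. Then the quotient by $\equiv$ of the unravelling $U(M^c_{\min})$ is a minimal partial epistemic frame, and the quotient by $\equiv$ of the unravelling $U(M^c_{\max})$ is a maximal partial epistemic frame.
   Context: Fix a finite set $A$ of agents and a countable set $\mathsf{AP}$. $\mathcal L_D$: $\varphi::=p\mid\neg\varphi\mid\varphi\wedge\varphi\mid D_B\varphi$, $\emptyset\ne B\subseteq A$; $K_a\varphi:=D_{\{a\}}\varphi$, $\mathsf{dead}(a):=K_a\bot$, $\mathsf{alive}(a):=\neg\mathsf{dead}(a)$, $\mathsf{dead}(B):=\bigwedge_{a\in B}\mathsf{dead}(a)$ (empty conjunction $=\top$), $\mathsf{alive}(B):=\neg D_B\bot$, $\overline B=A\setminus B$. $\mathbf{SC}$: propositional tautologies, modus ponens, necessitation, and for non-empty $B,B'$: $D_B(\varphi\Rightarrow\psi)\Rightarrow(D_B\varphi\Rightarrow D_B\psi)$; $\varphi\Rightarrow D_B\neg D_B\neg\varphi$; $D_B\varphi\Rightarrow D_BD_B\varphi$; $D_B\varphi\Rightarrow D_{B'}\varphi$ ($B\subseteq B'$); $\mathsf{alive}(B)\wedge\mathsf{alive}(B')\Rightarrow\mathsf{alive}(B\cup B')$; $\bigvee_{a\in A}\mathsf{alive}(a)$; $\mathsf{alive}(B)\wedge\mathsf{dead}(\overline B)\wedge\varphi\Rightarrow D_B(\mathsf{dead}(\overline B)\Rightarrow\varphi)$.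 $\mathbf{SC}_{\min}$ adds $\mathsf{alive}(B)\wedge\mathsf{dead}(\overline B)\Rightarrow D_B\mathsf{dead}(\overline B)$ for non-empty $B\subsetneq A$; $\mathbf{SC}_{\max}$ adds $\mathsf{alive}(B)\Rightarrow\neg D_B\neg\mathsf{dead}(\overline B)$ for non-empty $B\subsetneq A$. For a system $\mathbf L$, its canonical pseudo-model has as worlds the maximal $\mathbf L$-consistent sets, with $\Gamma\sim^c_B\Delta$ iff $D_B\varphi\in\Gamma$ implies $\varphi\in\Delta$ ($B\subseteq A$). Histories: $h=(\Gamma_0,B_1,\Gamma_1,\dots,B_k,\Gamma_k)$, $k\ge0$, $B_i\subseteq A$, $\Gamma_{i-1}\sim^c_{B_i}\Gamma_i$; $h\to_ah'$ iff $h'=(h,B_{k+1},\Gamma_{k+1})$ with $a\in B_{k+1}$. The unravelling has histories as worlds and $\sim^u_a$ the transitive closure of $\to_a\cup\leftarrow_a$; $\mathrm{live}(h)=\{a:h\sim^u_ah\}$; $h\equiv h'$ iff $\mathrm{live}(h)=\mathrm{live}(h')$ and $h\sim^u_ah'$ for all $a\in\mathrm{live}(h)$. The quotient frame has worlds the classes $[h]$ and $[h_1]\sim'_a[h_2]$ iff $h_1\sim^u_ah_2$. A frame $\langle W,\sim\rangle$ with symmetric transitive $\sim_a$ and $\mathrm{live}(w)=\{a:w\sim_aw\}$ is minimal if whenever $\mathrm{live}(w)\subsetneq\mathrm{live}(w')$ there is $a\in\mathrm{live}(w)$ with $w\not\sim_aw'$; maximal if for every $w'$ and every non-empty $B\subsetneq\mathrm{live}(w')$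 there is $w$ with $\mathrm{live}(w)=B$ and $w\sim_aw'$ for all $a\in B$. -}

module Defs where

open import Level using (Level; 0ℓ) renaming (suc to lsuc)
open import Data.Nat using (ℕ; zero)
open import Data.Fin using (Fin)
open import Data.Fin.Subset using (Subset; _∈_; _∉_; _⊆_; _∪_; ∁; ⁅_⁆; Nonempty)
open import Data.Fin.Subset.Properties using (nonempty?; _∈?_)
open import Data.List using (List; []; _∷_; map; filter; allFin)
open import Data.List.Relation.Unary.All using (All)
open import Data.Bool using (Bool; true; false; not; _∧_)
open import Data.Product using (Σ; ∃; ∃-syntax; _×_; _,_)
open import Data.Sum using (_⊎_)
open import Relation.Nullary using (¬_)
open import Relation.Nullary.Decidable using (True)
open import Relation.Binary.PropositionalEquality using (_≡_)
open import Relation.Binary.Construct.Closure.Transitive using (TransClosure)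
open import Relation.Binary.Construct.Closure.Symmetric using (SymClosure)
open import Function.Bundles using (_⇔_)

module Logic (n : ℕ) where

  Agent : Set
  Agent = Fin n

  -- proof-irrelevant (decidable) non-emptiness of a coalition B ⊆ A
  NE : Subset n → Set
  NE B = True (nonempty? B)

  data Form : Set where
    var  : ℕ → Form
    ¬'_  : Form → Form
    _∧'_ : Form → Form → Form
    D    : (B : Subset n) → NE B → Form → Form

  infixr 6 _∧'_
  infixr 5 _⇒_ _∨'_

  ⊥' : Form
  ⊥' = var zero ∧' ¬' var zero

  ⊤' : Form
  ⊤' = ¬' ⊥'

  _⇒_ : Form → Form → Form
  φ ⇒ ψ = ¬' (φ ∧' ¬' ψ)

  _∨'_ : Form → Form → Form
  φ ∨' ψ = ¬' (¬' φ ∧' ¬' ψ)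

  ⋀ : List Form → Form
  ⋀ []       = ⊤'
  ⋀ (φ ∷ φs) = φ ∧' ⋀ φs

  ⋁ : List Form → Form
  ⋁ []       = ⊥'
  ⋁ (φ ∷ φs) = φ ∨' ⋁ φs

  singletonNE : (a : Agent) → NE ⁅ a ⁆
  singletonNE a = Relation.Nullary.Decidable.fromWitness {a? = nonempty? ⁅ a ⁆}
                    (a , Data.Fin.Subset.Properties.x∈⁅x⁆ a)

  K : Agent → Form → Form
  K a φ = D ⁅ a ⁆ (singletonNE a) φ

  dead : Agent → Form
  dead a = K a ⊥'

  alive₁ : Agent → Form
  alive₁ a = ¬' dead a

  deadS : Subset n → Form
  deadS B = ⋀ (map dead (filter (_∈? B) (allFin n)))

  alive : (B : Subset n) → NE B → Form
  alive B ne = ¬' D B ne ⊥'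

  -- propositional tautologies: true under every Boolean valuation that
  -- treats atoms and modal formulas D_B ψ as propositional letters
  eval : (Form → Bool) → Form → Bool
  eval v (var p)    = v (var p)
  eval v (¬' φ)     = not (eval v φ)
  eval v (φ ∧' ψ)   = eval v φ ∧ eval v ψ
  eval v (D B ne φ) = v (D B ne φ)

  Taut : Form → Set
  Taut φ = (v : Form → Bool) → eval v φ ≡ true

  data SCAx : Form → Set where
    taut  : ∀ {φ} → Taut φ → SCAx φ
    axK   : ∀ B ne φ ψ → SCAx (D B ne (φ ⇒ ψ) ⇒ (D B ne φ ⇒ D B ne ψ))
    axB   : ∀ B ne φ → SCAx (φ ⇒ D B ne (¬' D B ne (¬' φ)))
    ax4   : ∀ B ne φ → SCAx (D B ne φ ⇒ D B ne (D B ne φ))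
    mono  : ∀ B ne B' ne' φ → B ⊆ B' → SCAx (D B ne φ ⇒ D B' ne' φ)
    union : ∀ B ne B' ne' ne'' →
            SCAx (alive B ne ∧' alive B' ne' ⇒ alive (B ∪ B') ne'')
    some  : SCAx (⋁ (map alive₁ (allFin n)))
    sync  : ∀ B ne φ →
            SCAx (alive B ne ∧' deadS (∁ B) ∧' φ ⇒ D B ne (deadS (∁ B) ⇒ φ))

  -- extra axiom of SC_min  (B non-empty, B ≠ A, i.e. ∁ B non-empty)
  data MinAx : Form → Set where
    axMin : ∀ B ne → NE (∁ B) →
            MinAx (alive B ne ∧' deadS (∁ B) ⇒ D B ne (deadS (∁ B)))

  data MaxAx : Form → Set where
    axMax : ∀ B ne → NE (∁ B) →
            MaxAx (alive B ne ⇒ ¬' D B ne (¬' deadS (∁ B)))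

  -- a system = SC extended by a set of extra axioms
  System : Set₁
  System = Form → Set

  data _⊢_ (X : System) : Form → Set where
    axSC : ∀ {φ} → SCAx φ → X ⊢ φ
    axX  : ∀ {φ} → X φ → X ⊢ φ
    mp   : ∀ {φ ψ} → X ⊢ (φ ⇒ ψ) → X ⊢ φ → X ⊢ ψ
    nec  : ∀ {φ} B ne → X ⊢ φ → X ⊢ D B ne φ

  SCmin SCmax : System
  SCmin = MinAx
  SCmax = MaxAx

  FSet : Set₁
  FSet = Form → Set

  Consistent : System → FSet → Set
  Consistent L Γ = ¬ (Σ (List Form) λ φs → All Γ φs × (L ⊢ (⋀ φs ⇒ ⊥')))

  _⊆F_ : FSet → FSet → Set
  Γ ⊆F Δ = ∀ φ → Γ φ → Δ φ

  record MCS (L : System) : Set₁ where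
    field
      set     : FSet
      cons    : Consistent L set
      maximal : (Δ : FSet) → Consistent L Δ → set ⊆F Δ → Δ ⊆F set
  open MCS public

  -- canonical relation  Γ ∼^c_B Δ  iff  D_B φ ∈ Γ implies φ ∈ Δ
  -- (for B = ∅ there is no D_B in the language, so the condition is vacuous)
  _∼c[_]_ : ∀ {L} → MCS L → Subset n → MCS L → Set
  Γ ∼c[ B ] Δ = ∀ ne φ → set Γ (D B ne φ) → set Δ φ

  module Unravel (L : System) where
    mutual
      data History : Set₁ where
        root : MCS L → History
        ext  : (h : History) (B : Subset n) (Γ : MCS L) →
               lastW h ∼c[ B ] Γ → History

      lastW : History → MCS L
      lastW (root Γ)       = Γ
      lastW (ext _ _ Γ _)  = Γ

    data Step (a : Agent) : History → History → Set₁ where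
      step : ∀ {h B Γ r} → a ∈ B → Step a h (ext h B Γ r)

    _∼u[_]_ : History → Agent → History → Set₁
    h ∼u[ a ] h' = TransClosure (SymClosure (Step a)) h h'

    liveU : History → Agent → Set₁
    liveU h a = h ∼u[ a ] h

    _≡h_ : History → History → Set₁
    h ≡h h' = (∀ a → liveU h a ⇔ liveU h' a) × (∀ a → liveU h a → h ∼u[ a ] h')

  record Frame : Set₂ where
    field
      W   : Set₁
      _≈_ : W → W → Set₁          -- equality of worlds (setoid presentation)
      R   : Agent → W → W → Set₁

  module _ (F : Frame) where
    open Frame F

    live : W → Agent → Set₁
    live w a = R a w w

    IsPartialEpistemic : Set₁
    IsPartialEpistemic = ∀ a → (∀ {x y} → R a x y → R a y x)
                             × (∀ {x y z} → R a x y → R a y z → R a x z)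

    _⊊L_ : W → W → Set₁
    w ⊊L w' = (∀ a → live w a → live w' a) × ¬ (∀ a → live w' a → live w a)

    IsMinimal : Set₁
    IsMinimal = ∀ w w' → w ⊊L w' → ∃[ a ] (live w a × ¬ R a w w')

    IsMaximal : Set₁
    IsMaximal = ∀ w' (B : Subset n) → Nonempty B →
                (∀ a → a ∈ B → live w' a) → ¬ (∀ a → live w' a → a ∈ B) →
                ∃[ w ] ((∀ a → live w a ⇔ a ∈ B) × (∀ a → a ∈ B → R a w w'))

  -- the quotient U(M^c_L)/≡ : worlds are classes [h], presented as the
  -- setoid of histories modulo ≡, with [h₁] ∼'_a [h₂] iff h₁ ∼^u_a h₂
  Quotient : System → Frame
  Quotient L = record { W = History ; _≈_ = _≡h_ ; R = λ a h h' → h ∼u[ a ] h' }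
    where open Unravel L

-- In the canonical pseudo-model a history h has live set {a | alive(a) ∈ last h}, and a formula
-- D_B χ travels along every edge whose label contains B (axioms 4 and monotonicity; axiom B to
-- travel backwards). Histories form a tree, so if every agent of B links h to h′, then every edge
-- on the tree path between them has a label containing B, and D_B-formulas travel from h to h′.
--
-- Minimality: let B = live(h) ⊊ live(h′) with every agent of B linking h to h′. At h,
-- alive(B) ∧ dead(∁B) holds, hence D_B dead(∁B) by the SC_min axiom. It travels to h′, where
-- alive(B) makes D_B reflexive, so dead(∁B) holds at h′, contradicting a live agent of h′ outside B.
--
-- Maximality: for B ⊊ live(h′), the SC_max axiom gives a B-successor of the last world of h′ in
-- which dead(∁B) holds; extending h′ by this step yields a history whose live set is exactly B.

module Submission where

open import Defs
open import Level using (0ℓ; Lift; lift; lower) renaming (suc to lsuc)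
open import Data.Bool using (Bool; true; false; not; T)
open import Data.Bool.Properties using (T-≡; T-∧; T-irrelevant)
open import Data.Nat using (ℕ; zero; suc; _+_; _≤_)
open import Data.Nat.Properties using (+-comm; ≤-refl; ≤-trans; m≤n⇒m≤1+n; 1+n≰n)
open import Data.Nat.Binary using (ℕᵇ; 2[1+_]; 1+[2_]; toℕ) renaming (zero to 0ᵇ)
open import Data.Nat.Binary.Properties using (toℕ-injective; 2[1+_]-injective; 1+[2_]-injective)
open import Data.Vec as Vec using (Vec)
open import Data.Vec.Properties using (lookup∘tabulate; []=⇒lookup; lookup⇒[]=)
open import Data.Fin.Properties using (¬∀⟶∃¬)
open import Data.List.Properties using (∷-injective; ∷-injectiveʳ)
open import Data.List using (List; []; _∷_; _++_; filter; allFin)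
open import Data.List.Relation.Unary.All as All using (All; []; _∷_)
import Data.List.Relation.Unary.All.Properties as All
open import Data.Product using (Σ; ∃-syntax; _×_; _,_; proj₁; proj₂)
open import Data.Sum using (_⊎_; inj₁; inj₂)
open import Data.Empty using (⊥; ⊥-elim)
open import Data.List.Membership.Propositional using () renaming (_∈_ to _∈ₗ_)
open import Data.List.Membership.Propositional.Properties using (∈-filter⁺; ∈-filter⁻; ∈-allFin; ∈-map⁺)
open import Data.List.Relation.Unary.Any using (here; there)
open import Data.Fin.Subset as Subset using (Subset; _∈_; _⊆_; _∪_; ∁; ⁅_⁆; Nonempty)
open import Data.Fin.Subset.Properties
  using (_∈?_; nonempty?; x∈⁅x⁆; x∈⁅y⁆⇒x≡y; p⊆p∪q; q⊆p∪q; ∉⊥; x∈∁p⇒x∉p; x∉p⇒x∈∁p)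
open import Relation.Binary.Construct.Closure.Transitive as Plus using ([_]; _∷_)
open import Relation.Binary.Construct.Closure.Symmetric as Sym using (SymClosure; fwd; bwd)
open import Relation.Nullary using (¬_; Dec; yes; no)
open import Relation.Nullary.Decidable using (isYes; fromWitness; toWitness; decidable-stable)
open import Relation.Binary.PropositionalEquality using (_≡_; refl; sym; trans; cong; subst)
open import Function using (_∘_)
open import Function.Bundles using (_⇔_; mk⇔; Equivalence)
open import Axiom.ExcludedMiddle using (ExcludedMiddle)

module _ (n : ℕ) where
  open Logic n

  private variable
    v : Form → Bool
    φ ψ χ θ : Form
    φs : List Form

  -- A record rather than T (eval v φ), so that φ can be inferred from the type.
  infix 4 _⊨_
  record _⊨_ (v : Form → Bool) (φ : Form) : Set where
    constructor ⊨⁺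
    field ⊨⁻ : T (eval v φ)
  open _⊨_

  T-not : ∀ b → T (not b) ⇔ (¬ T b)
  T-not true  = mk⇔ (λ ()) (λ ¬t → ¬t _)
  T-not false = mk⇔ (λ _ ()) _

  ⊨-∧⁺ : v ⊨ φ → v ⊨ ψ → v ⊨ φ ∧' ψ
  ⊨-∧⁺ (⊨⁺ p) (⊨⁺ q) = ⊨⁺ (Equivalence.from T-∧ (p , q))

  ⊨-∧ˡ : v ⊨ φ ∧' ψ → v ⊨ φ
  ⊨-∧ˡ (⊨⁺ p) = ⊨⁺ (proj₁ (Equivalence.to T-∧ p))

  ⊨-∧ʳ : v ⊨ φ ∧' ψ → v ⊨ ψ
  ⊨-∧ʳ (⊨⁺ p) = ⊨⁺ (proj₂ (Equivalence.to T-∧ p))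

  ⊨-¬⁺ : ¬ v ⊨ φ → v ⊨ ¬' φ
  ⊨-¬⁺ {v} {φ} ¬p = ⊨⁺ (Equivalence.from (T-not (eval v φ)) (λ p → ¬p (⊨⁺ p)))

  ⊨-¬⁻ : v ⊨ ¬' φ → ¬ v ⊨ φ
  ⊨-¬⁻ {v} {φ} (⊨⁺ p) (⊨⁺ q) = Equivalence.to (T-not (eval v φ)) p q

  ⊨-¬¬ : v ⊨ ¬' ¬' φ → v ⊨ φ
  ⊨-¬¬ {v} {φ} p with eval v φ in eq
  ... | true  = ⊨⁺ (subst T (sym eq) _)
  ... | false = ⊥-elim (⊨-¬⁻ p (⊨-¬⁺ (λ q → subst T eq (⊨⁻ q))))

  ⊨-⇒⁺ : (v ⊨ φ → v ⊨ ψ) → v ⊨ φ ⇒ ψ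
  ⊨-⇒⁺ f = ⊨-¬⁺ (λ p → ⊨-¬⁻ (⊨-∧ʳ p) (f (⊨-∧ˡ p)))

  ⊨-⇒⁻ : v ⊨ φ ⇒ ψ → v ⊨ φ → v ⊨ ψ
  ⊨-⇒⁻ p q = ⊨-¬¬ (⊨-¬⁺ (λ ¬ψ → ⊨-¬⁻ p (⊨-∧⁺ q ¬ψ)))

  ⊭⊥ : ¬ v ⊨ ⊥'
  ⊭⊥ p = ⊨-¬⁻ (⊨-∧ʳ p) (⊨-∧ˡ p)

  ⊨⊤ : v ⊨ ⊤'
  ⊨⊤ = ⊨-¬⁺ ⊭⊥

  ⊨-⋀⁺ : All (v ⊨_) φs → v ⊨ ⋀ φs
  ⊨-⋀⁺ []       = ⊨⊤
  ⊨-⋀⁺ (p ∷ ps) = ⊨-∧⁺ p (⊨-⋀⁺ ps)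

  ⊨-⋀⁻ : ∀ φs → v ⊨ ⋀ φs → All (v ⊨_) φs
  ⊨-⋀⁻ []       _ = []
  ⊨-⋀⁻ (φ ∷ φs) p = ⊨-∧ˡ p ∷ ⊨-⋀⁻ φs (⊨-∧ʳ p)

  module Derivations (L : System) where

    ⊢-taut : (∀ v → v ⊨ φ) → L ⊢ φ
    ⊢-taut f = axSC (taut (λ v → Equivalence.to T-≡ (⊨⁻ (f v))))

    ⊢-sem₁ : (∀ v → v ⊨ φ → v ⊨ ψ) → L ⊢ φ → L ⊢ ψ
    ⊢-sem₁ f d = mp (⊢-taut (λ v → ⊨-⇒⁺ (f v))) d

    ⊢-sem₂ : (∀ v → v ⊨ φ → v ⊨ ψ → v ⊨ χ) → L ⊢ φ → L ⊢ ψ → L ⊢ χ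
    ⊢-sem₂ f d e = mp (mp (⊢-taut (λ v → ⊨-⇒⁺ (λ p → ⊨-⇒⁺ (f v p)))) d) e

    ⊢-D-mono : ∀ {B ne} → L ⊢ (φ ⇒ ψ) → L ⊢ (D B ne φ ⇒ D B ne ψ)
    ⊢-D-mono {B = B} {ne} d = mp (axSC (axK B ne _ _)) (nec B ne d)

  -- A prefix-free binary code, written with a continuation so that injectivity can be
  -- proved together with the remainder.
  unaryBits : ℕ → List Bool → List Bool
  unaryBits zero    r = false ∷ r
  unaryBits (suc p) r = true ∷ unaryBits p r

  vecBits : ∀ {k} → Vec Bool k → List Bool → List Bool
  vecBits Vec.[]       r = r
  vecBits (b Vec.∷ bs) r = b ∷ vecBits bs r

  formBits : Form → List Bool → List Bool
  formBits (var p)    r = false ∷ false ∷ unaryBits p r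
  formBits (¬' φ)     r = false ∷ true ∷ formBits φ r
  formBits (φ ∧' ψ)   r = true ∷ false ∷ formBits φ (formBits ψ r)
  formBits (D B _ φ)  r = true ∷ true ∷ vecBits B (formBits φ r)

  unaryBits-injective : ∀ p q {r s} → unaryBits p r ≡ unaryBits q s → p ≡ q × r ≡ s
  unaryBits-injective zero    zero    refl = refl , refl
  unaryBits-injective (suc p) (suc q) e with unaryBits-injective p q (∷-injectiveʳ e)
  ... | refl , r≡s = refl , r≡s

  vecBits-injective : ∀ {k} (B C : Vec Bool k) {r s} → vecBits B r ≡ vecBits C s → B ≡ C × r ≡ s
  vecBits-injective Vec.[]       Vec.[]       e = refl , e
  vecBits-injective (b Vec.∷ B) (c Vec.∷ C) e with ∷-injective e
  ... | refl , e′ with vecBits-injective B C e′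
  ... | refl , r≡s = refl , r≡s

  D-irrelevant : ∀ {B} (ne ne′ : NE B) φ → D B ne φ ≡ D B ne′ φ
  D-irrelevant {B} ne ne′ φ = cong (λ x → D B x φ) (T-irrelevant ne ne′)

  formBits-injective : ∀ φ ψ {r s} → formBits φ r ≡ formBits ψ s → φ ≡ ψ × r ≡ s
  formBits-injective (var p) (var q) e with unaryBits-injective p q (∷-injectiveʳ (∷-injectiveʳ e))
  ... | refl , r≡s = refl , r≡s
  formBits-injective (¬' φ) (¬' ψ) e with formBits-injective φ ψ (∷-injectiveʳ (∷-injectiveʳ e))
  ... | refl , r≡s = refl , r≡s
  formBits-injective (φ₁ ∧' φ₂) (ψ₁ ∧' ψ₂) e with formBits-injective φ₁ ψ₁ (∷-injectiveʳ (∷-injectiveʳ e))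
  ... | refl , e′ with formBits-injective φ₂ ψ₂ e′
  ... | refl , r≡s = refl , r≡s
  formBits-injective (D B ne φ) (D C ne′ ψ) e with vecBits-injective B C (∷-injectiveʳ (∷-injectiveʳ e))
  ... | refl , e′ with formBits-injective φ ψ e′
  ... | refl , r≡s = D-irrelevant ne ne′ φ , r≡s
  formBits-injective (var _)   (¬' _)    ()
  formBits-injective (var _)   (_ ∧' _)  ()
  formBits-injective (var _)   (D _ _ _) ()
  formBits-injective (¬' _)    (var _)   ()
  formBits-injective (¬' _)    (_ ∧' _)  ()
  formBits-injective (¬' _)    (D _ _ _) ()
  formBits-injective (_ ∧' _)  (var _)   ()
  formBits-injective (_ ∧' _)  (¬' _)    ()
  formBits-injective (_ ∧' _)  (D _ _ _) ()
  formBits-injective (D _ _ _) (var _)   ()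
  formBits-injective (D _ _ _) (¬' _)    ()
  formBits-injective (D _ _ _) (_ ∧' _)  ()

  fromBits : List Bool → ℕᵇ
  fromBits []           = 0ᵇ
  fromBits (false ∷ bs) = 1+[2 fromBits bs ]
  fromBits (true ∷ bs)  = 2[1+ fromBits bs ]

  fromBits-injective : ∀ bs cs → fromBits bs ≡ fromBits cs → bs ≡ cs
  fromBits-injective []           []           _    = refl
  fromBits-injective (false ∷ bs) (false ∷ cs) e =
    cong (false ∷_) (fromBits-injective bs cs (1+[2_]-injective e))
  fromBits-injective (true ∷ bs)  (true ∷ cs)  e =
    cong (true ∷_) (fromBits-injective bs cs (2[1+_]-injective e))
  fromBits-injective []           (false ∷ _)  ()
  fromBits-injective []           (true ∷ _)   ()
  fromBits-injective (false ∷ _)  []           ()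
  fromBits-injective (false ∷ _)  (true ∷ _)   ()
  fromBits-injective (true ∷ _)   []           ()
  fromBits-injective (true ∷ _)   (false ∷ _)  ()

  code : Form → ℕ
  code φ = toℕ (fromBits (formBits φ []))

  code-injective : code φ ≡ code ψ → φ ≡ ψ
  code-injective {φ} {ψ} e =
    proj₁ (formBits-injective φ ψ (fromBits-injective _ _ (toℕ-injective e)))

  module MaximalConsistent (L : System) where
    open Derivations L

    private variable
      S S′ : FSet

    insert : Form → FSet → FSet
    insert θ S χ = S χ ⊎ χ ≡ θ

    discharge : ∀ ψs → All (insert θ S) ψs →
                ∃[ ρs ] (All S ρs × L ⊢ (⋀ ρs ⇒ (θ ⇒ ⋀ ψs)))
    discharge []               []            = [] , [] , ⊢-taut (λ _ → ⊨-⇒⁺ (λ _ → ⊨-⇒⁺ (λ _ → ⊨⊤)))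
    discharge (χ ∷ ψs) (inj₁ p    ∷ ps) with discharge ψs ps
    ... | ρs , qs , d = χ ∷ ρs , p ∷ qs , ⊢-sem₁ (λ _ h → ⊨-⇒⁺ (λ r → ⊨-⇒⁺ (λ t →
                          ⊨-∧⁺ (⊨-∧ˡ r) (⊨-⇒⁻ (⊨-⇒⁻ h (⊨-∧ʳ r)) t)))) d
    discharge (χ ∷ ψs) (inj₂ refl ∷ ps) with discharge ψs ps
    ... | ρs , qs , d = ρs , qs , ⊢-sem₁ (λ _ h → ⊨-⇒⁺ (λ r → ⊨-⇒⁺ (λ t →
                          ⊨-∧⁺ t (⊨-⇒⁻ (⊨-⇒⁻ h r) t)))) d

    insert-consistent : (∀ ρs → All S ρs → ¬ L ⊢ (⋀ ρs ⇒ ¬' θ)) → Consistent L (insert θ S)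
    insert-consistent ¬refute (ψs , ps , d) with discharge ψs ps
    ... | ρs , qs , e = ¬refute ρs qs (⊢-sem₂ (λ _ a b → ⊨-⇒⁺ (λ r → ⊨-¬⁺ (λ t →
                          ⊭⊥ (⊨-⇒⁻ a (⊨-⇒⁻ (⊨-⇒⁻ b r) t))))) d e)

    consistent-⊆ : S ⊆F S′ → Consistent L S′ → Consistent L S
    consistent-⊆ S⊆S′ c (ψs , ps , d) = c (ψs , All.map (S⊆S′ _) ps , d)

    infix 4 _∈ₘ_
    _∈ₘ_ : Form → MCS L → Set
    φ ∈ₘ Γ = set Γ φ

    module _ (Γ : MCS L) where

      ∈ₘ-insert : Consistent L (insert θ (set Γ)) → θ ∈ₘ Γ
      ∈ₘ-insert {θ} c = maximal Γ (insert θ (set Γ)) c (λ _ → inj₁) θ (inj₂ refl)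

      ∈ₘ-closed : All (_∈ₘ Γ) φs → L ⊢ (⋀ φs ⇒ ψ) → ψ ∈ₘ Γ
      ∈ₘ-closed {φs} ps d = ∈ₘ-insert (insert-consistent λ ρs qs e → cons Γ (φs ++ ρs , All.++⁺ ps qs ,
        ⊢-sem₂ (λ _ a b → ⊨-⇒⁺ (λ r → let (r₁ , r₂) = All.++⁻ φs (⊨-⋀⁻ (φs ++ ρs) r) in
                 ⊥-elim (⊨-¬⁻ (⊨-⇒⁻ b (⊨-⋀⁺ r₂)) (⊨-⇒⁻ a (⊨-⋀⁺ r₁))))) d e))

      ∈ₘ-theorem : L ⊢ φ → φ ∈ₘ Γ
      ∈ₘ-theorem d = ∈ₘ-closed [] (⊢-sem₁ (λ _ p → ⊨-⇒⁺ (λ _ → p)) d)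

      ∈ₘ-⊢mp : L ⊢ (φ ⇒ ψ) → φ ∈ₘ Γ → ψ ∈ₘ Γ
      ∈ₘ-⊢mp d p = ∈ₘ-closed (p ∷ []) (⊢-sem₁ (λ _ h → ⊨-⇒⁺ (λ r → ⊨-⇒⁻ h (⊨-∧ˡ r))) d)

      ∈ₘ-sem₁ : (∀ v → v ⊨ φ → v ⊨ ψ) → φ ∈ₘ Γ → ψ ∈ₘ Γ
      ∈ₘ-sem₁ f = ∈ₘ-⊢mp (⊢-taut (λ v → ⊨-⇒⁺ (f v)))

      ∈ₘ-sem₂ : (∀ v → v ⊨ φ → v ⊨ χ → v ⊨ ψ) → φ ∈ₘ Γ → χ ∈ₘ Γ → ψ ∈ₘ Γ
      ∈ₘ-sem₂ f p q = ∈ₘ-closed (p ∷ q ∷ [])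
        (⊢-taut (λ v → ⊨-⇒⁺ (λ r → f v (⊨-∧ˡ r) (⊨-∧ˡ (⊨-∧ʳ r)))))

      ∈ₘ-mp : (φ ⇒ ψ) ∈ₘ Γ → φ ∈ₘ Γ → ψ ∈ₘ Γ
      ∈ₘ-mp = ∈ₘ-sem₂ (λ _ → ⊨-⇒⁻)

      ∈ₘ-contra : L ⊢ (φ ⇒ ψ) → ¬' ψ ∈ₘ Γ → ¬' φ ∈ₘ Γ
      ∈ₘ-contra d = ∈ₘ-⊢mp (⊢-sem₁ (λ _ a → ⊨-⇒⁺ (λ b → ⊨-¬⁺ (λ c → ⊨-¬⁻ b (⊨-⇒⁻ a c)))) d)

      ∈ₘ-∧ : φ ∈ₘ Γ → ψ ∈ₘ Γ → (φ ∧' ψ) ∈ₘ Γ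
      ∈ₘ-∧ = ∈ₘ-sem₂ (λ _ → ⊨-∧⁺)

      ∈ₘ-¬ : φ ∈ₘ Γ → ¬ (¬' φ ∈ₘ Γ)
      ∈ₘ-¬ p q = cons Γ (_ ∷ _ ∷ [] , p ∷ q ∷ [] ,
        ⊢-taut (λ _ → ⊨-⇒⁺ (λ r → ⊥-elim (⊨-¬⁻ (⊨-∧ˡ (⊨-∧ʳ r)) (⊨-∧ˡ r)))))

      ⊥∉ₘ : ¬ (⊥' ∈ₘ Γ)
      ⊥∉ₘ p = ∈ₘ-¬ p (∈ₘ-theorem (⊢-taut (λ _ → ⊨⊤)))

      ∉ₘ⇒¬∈ₘ : ¬ (φ ∈ₘ Γ) → ¬' φ ∈ₘ Γ
      ∉ₘ⇒¬∈ₘ φ∉ = ∈ₘ-insert (insert-consistent λ ρs qs e →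
        φ∉ (∈ₘ-closed qs (⊢-sem₁ (λ _ a → ⊨-⇒⁺ (λ r → ⊨-¬¬ (⊨-⇒⁻ a r))) e)))

      ∉ₘ-¬⇒∈ₘ : ¬ (¬' φ ∈ₘ Γ) → φ ∈ₘ Γ
      ∉ₘ-¬⇒∈ₘ ¬φ∉ = ∈ₘ-sem₁ (λ _ → ⊨-¬¬) (∉ₘ⇒¬∈ₘ ¬φ∉)

      ∈ₘ-stable : ¬ ¬ (φ ∈ₘ Γ) → φ ∈ₘ Γ
      ∈ₘ-stable ¬¬φ = ∈ₘ-insert (insert-consistent λ ρs qs e → ¬¬φ (λ p → ∈ₘ-¬ p (∈ₘ-closed qs e)))

      ∈ₘ-⋀⁺ : All (_∈ₘ Γ) φs → ⋀ φs ∈ₘ Γ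
      ∈ₘ-⋀⁺ ps = ∈ₘ-closed ps (⊢-taut (λ _ → ⊨-⇒⁺ (λ r → r)))

      ∈ₘ-⋀⁻ : ∀ φs → ⋀ φs ∈ₘ Γ → All (_∈ₘ Γ) φs
      ∈ₘ-⋀⁻ []       _ = []
      ∈ₘ-⋀⁻ (φ ∷ φs) p = ∈ₘ-sem₁ (λ _ → ⊨-∧ˡ) p ∷ ∈ₘ-⋀⁻ φs (∈ₘ-sem₁ (λ _ → ⊨-∧ʳ) p)

    stage : FSet → ℕ → FSet
    stage S zero    = S
    stage S (suc k) χ = stage S k χ ⊎ (code χ ≡ k × Consistent L (insert χ (stage S k)))

    stage-suc-split : ∀ k ψs → All (stage S (suc k)) ψs →
                      All (stage S k) ψs
                      ⊎ ∃[ χ ] (Consistent L (insert χ (stage S k)) × code χ ≡ k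
                                × All (insert χ (stage S k)) ψs)
    stage-suc-split k []       []             = inj₁ []
    stage-suc-split k (ψ ∷ ψs) (inj₁ p ∷ ps) with stage-suc-split k ψs ps
    ... | inj₁ qs              = inj₁ (p ∷ qs)
    ... | inj₂ (χ , c , e , qs) = inj₂ (χ , c , e , inj₁ p ∷ qs)
    stage-suc-split k (ψ ∷ ψs) (inj₂ (e₁ , c₁) ∷ ps) with stage-suc-split k ψs ps
    ... | inj₁ qs              = inj₂ (ψ , c₁ , e₁ , inj₂ refl ∷ All.map inj₁ qs)
    ... | inj₂ (χ , c , e , qs) = inj₂ (χ , c , e , inj₂ (code-injective (trans e₁ (sym e))) ∷ qs)

    stage-consistent : Consistent L S → ∀ k → Consistent L (stage S k)
    stage-consistent c zero = c
    stage-consistent c (suc k) (ψs , ps , d) with stage-suc-split k ψs ps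
    ... | inj₁ qs              = stage-consistent c k (ψs , qs , d)
    ... | inj₂ (χ , c′ , _ , qs) = c′ (ψs , qs , d)

    stage-mono : ∀ d k → stage S k ⊆F stage S (d + k)
    stage-mono zero    k φ p = p
    stage-mono (suc d) k φ p = inj₁ (stage-mono d k φ p)

    limit : FSet → FSet
    limit S χ = ∃[ k ] stage S k χ

    limit-finite : ∀ ψs → All (limit S) ψs → ∃[ k ] All (stage S k) ψs
    limit-finite []       []              = zero , []
    limit-finite {S} (ψ ∷ ψs) ((k , p) ∷ ps) with limit-finite ψs ps
    ... | l , qs = l + k , stage-mono l k ψ p
                 ∷ All.map (λ {φ} q → subst (λ m → stage S m φ) (+-comm k l) (stage-mono k l φ q)) qs

    lindenbaum : Consistent L S → Σ (MCS L) λ Δ → S ⊆F set Δ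
    lindenbaum {S} c = record { set = limit S ; cons = limit-consistent ; maximal = limit-maximal }
                     , λ _ p → zero , p
      where
      limit-consistent : Consistent L (limit S)
      limit-consistent (ψs , ps , d) with limit-finite ψs ps
      ... | k , qs = stage-consistent c k (ψs , qs , d)

      limit-maximal : (Δ : FSet) → Consistent L Δ → limit S ⊆F Δ → Δ ⊆F limit S
      limit-maximal Δ cΔ sub χ χ∈Δ = suc (code χ) , inj₂ (refl , consistent-⊆ ⊆Δ cΔ)
        where
        ⊆Δ : insert χ (stage S (code χ)) ⊆F Δ
        ⊆Δ φ (inj₁ p)    = sub φ (code χ , p)
        ⊆Δ φ (inj₂ refl) = χ∈Δ

  members : Subset n → List Agent
  members B = filter (_∈? B) (allFin n)

  ∈-members : ∀ {a B} → a ∈ B → a ∈ₗ members B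
  ∈-members a∈B = ∈-filter⁺ (_∈? _) (∈-allFin _) a∈B

  All-members : ∀ {ℓ} {P : Agent → Set ℓ} {B} → (∀ {a} → a ∈ B → P a) → All P (members B)
  All-members {B = B} f = All.tabulate (λ m → f (proj₂ (∈-filter⁻ (_∈? B) {xs = allFin n} m)))

  NE-intro : ∀ {B} → Nonempty B → NE B
  NE-intro = fromWitness

  NE-⊆ : ∀ {B C} → NE B → B ⊆ C → NE C
  NE-⊆ ne B⊆C with toWitness ne
  ... | a , a∈B = NE-intro (a , B⊆C a∈B)

  ⁅⁆-⊆ : ∀ {a : Agent} {C} → a ∈ C → ⁅ a ⁆ ⊆ C
  ⁅⁆-⊆ {a} {C} a∈C x∈⁅a⁆ = subst (_∈ C) (sym (x∈⁅y⁆⇒x≡y a x∈⁅a⁆)) a∈C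

  span : Agent → List Agent → Subset n
  span a []       = ⁅ a ⁆
  span a (b ∷ bs) = ⁅ a ⁆ ∪ span b bs

  ∈-span : ∀ {x} a bs → x ∈ₗ a ∷ bs → x ∈ span a bs
  ∈-span a []       (here refl) = x∈⁅x⁆ a
  ∈-span a (b ∷ bs) (here refl) = p⊆p∪q (span b bs) (x∈⁅x⁆ a)
  ∈-span a (b ∷ bs) (there m)   = q⊆p∪q ⁅ a ⁆ (span b bs) (∈-span b bs m)

  span-NE : ∀ a bs → NE (span a bs)
  span-NE a bs = NE-intro (a , ∈-span a bs (here refl))

  module Classical (lem : ExcludedMiddle (lsuc 0ℓ)) where

    dec : (P : Set) → Dec P
    dec P with lem {Lift (lsuc 0ℓ) P}
    ... | yes p = yes (lower p)
    ... | no ¬p = no (λ p → ¬p (lift p))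

    subset : (Agent → Set) → Subset n
    subset P = Vec.tabulate (λ a → isYes (dec (P a)))

    ∈-subset⁺ : ∀ {P a} → P a → a ∈ subset P
    ∈-subset⁺ {P} {a} p =
      lookup⇒[]= a _ (trans (lookup∘tabulate _ a) (Equivalence.to T-≡ (fromWitness {a? = dec (P a)} p)))

    ∈-subset⁻ : ∀ {P a} → a ∈ subset P → P a
    ∈-subset⁻ {P} {a} m =
      toWitness {a? = dec (P a)} (Equivalence.from T-≡ (trans (sym (lookup∘tabulate _ a)) ([]=⇒lookup m)))

    ¬⊆⇒∃∖ : {P Q : Agent → Set₁} → ¬ (∀ a → P a → Q a) → ∃[ a ] (P a × ¬ Q a)
    ¬⊆⇒∃∖ {P} {Q} P⊈Q with ¬∀⟶∃¬ n (λ a → P a → Q a) (λ _ → lem) P⊈Q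
    ... | a , ¬P⇒Q with lem {P a}
    ...   | yes p = a , p , (λ q → ¬P⇒Q (λ _ → q))
    ...   | no ¬p = ⊥-elim (¬P⇒Q (λ p → ⊥-elim (¬p p)))

  module CanonicalModel (L : System) where
    open Derivations L
    open MaximalConsistent L

    private variable
      Γ Δ : MCS L
      a : Agent
      B C : Subset n

    module _ (Γ : MCS L) where

      ∈ₘ-D-⋀ : ∀ {ne} φs → All (λ φ → D B ne φ ∈ₘ Γ) φs → D B ne (⋀ φs) ∈ₘ Γ
      ∈ₘ-D-⋀ {B} {ne} []       []       = ∈ₘ-theorem Γ (nec B ne (⊢-taut (λ _ → ⊨⊤)))
      ∈ₘ-D-⋀ {B} {ne} (φ ∷ φs) (p ∷ ps) =
        ∈ₘ-mp Γ (∈ₘ-mp Γ (∈ₘ-theorem Γ (axSC (axK B ne _ _)))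
                         (∈ₘ-⊢mp Γ (⊢-D-mono (⊢-taut (λ _ → ⊨-⇒⁺ (λ x → ⊨-⇒⁺ (⊨-∧⁺ x))))) p))
                (∈ₘ-D-⋀ φs ps)

      existence : ∀ {ne} θ → ¬' D B ne (¬' θ) ∈ₘ Γ → ∃[ Δ ] (Γ ∼c[ B ] Δ × θ ∈ₘ Δ)
      existence {B} {ne} θ ◇θ with lindenbaum (insert-consistent {S = λ φ → D B ne φ ∈ₘ Γ} λ ρs qs e →
                                     ∈ₘ-¬ Γ (∈ₘ-⊢mp Γ (⊢-D-mono e) (∈ₘ-D-⋀ ρs qs)) ◇θ)
      ... | Δ , sub = Δ , (λ ne′ φ p → sub φ (inj₁ (subst (_∈ₘ Γ) (D-irrelevant ne′ ne φ) p)))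
                        , sub θ (inj₂ refl)

    ∼c-sym : Γ ∼c[ C ] Δ → Δ ∼c[ C ] Γ
    ∼c-sym {Γ} {C} {Δ} Γ∼Δ ne φ Dφ∈Δ = ∈ₘ-stable Γ λ φ∉Γ →
      ∈ₘ-¬ Δ (∈ₘ-⊢mp Δ (⊢-D-mono (⊢-taut (λ _ → ⊨-⇒⁺ (λ x → ⊨-¬⁺ (λ y → ⊨-¬⁻ y x))))) Dφ∈Δ)
             (Γ∼Δ ne _ (∈ₘ-⊢mp Γ (axSC (axB C ne (¬' φ))) (∉ₘ⇒¬∈ₘ Γ φ∉Γ)))

    ∼c-transport : Γ ∼c[ C ] Δ → B ⊆ C → ∀ {ne χ} → D B ne χ ∈ₘ Γ → D B ne χ ∈ₘ Δ
    ∼c-transport {Γ} {C} {Δ} {B} Γ∼Δ B⊆C {ne} {χ} p =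
      Γ∼Δ neC _ (∈ₘ-⊢mp Γ (axSC (mono B ne C neC _ B⊆C)) (∈ₘ-⊢mp Γ (axSC (ax4 B ne χ)) p))
      where neC = NE-⊆ ne B⊆C

    ∼c-alive : Γ ∼c[ C ] Δ → a ∈ C → alive₁ a ∈ₘ Γ
    ∼c-alive {Γ} {C} {Δ} {a} Γ∼Δ a∈C = ∈ₘ-stable Γ λ a∉ →
      ⊥∉ₘ Δ (Γ∼Δ neC ⊥' (∈ₘ-⊢mp Γ (axSC (mono ⁅ a ⁆ (singletonNE a) C neC ⊥' (⁅⁆-⊆ a∈C)))
                                   (∉ₘ-¬⇒∈ₘ Γ a∉)))
      where neC = NE-⊆ (singletonNE a) (⁅⁆-⊆ a∈C)

    module _ (Γ : MCS L) where

      alive⇒∼c : ∀ {ne} → alive B ne ∈ₘ Γ → ∃[ Δ ] Γ ∼c[ B ] Δ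
      alive⇒∼c p
        with existence Γ ⊤' (∈ₘ-contra Γ (⊢-D-mono (⊢-taut (λ _ → ⊨-⇒⁺ (λ x → ⊥-elim (⊨-¬⁻ x ⊨⊤))))) p)
      ... | Δ , Γ∼Δ , _ = Δ , Γ∼Δ

      alive⇒D-reflexive : ∀ {ne χ} → alive B ne ∈ₘ Γ → D B ne χ ∈ₘ Γ → χ ∈ₘ Γ
      alive⇒D-reflexive {ne = ne} p q with alive⇒∼c p
      ... | Δ , Γ∼Δ = ∼c-sym {Γ = Γ} {Δ = Δ} Γ∼Δ ne _ (∼c-transport {Γ = Γ} {Δ = Δ} Γ∼Δ (λ x → x) q)

      alive-⊆ : ∀ {neB neC} → B ⊆ C → alive C neC ∈ₘ Γ → alive B neB ∈ₘ Γ
      alive-⊆ {B} {C} {neB} {neC} B⊆C = ∈ₘ-contra Γ (axSC (mono B neB C neC ⊥' B⊆C))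

      alive-span : ∀ bs → alive₁ a ∈ₘ Γ → All (λ b → alive₁ b ∈ₘ Γ) bs →
                   alive (span a bs) (span-NE a bs) ∈ₘ Γ
      alive-span {a} []       p [] = subst (_∈ₘ Γ) (cong ¬'_ (D-irrelevant _ _ ⊥')) p
      alive-span {a} (b ∷ bs) p (q ∷ qs) =
        ∈ₘ-⊢mp Γ (axSC (union ⁅ a ⁆ (singletonNE a) (span b bs) (span-NE b bs) (span-NE a (b ∷ bs))))
                 (∈ₘ-∧ Γ p (alive-span bs q qs))

      alive-cover : ∀ {ne b} as → All (λ a → alive₁ a ∈ₘ Γ) as → b ∈ B →
                    (∀ {x} → x ∈ B → x ∈ₗ as) → alive B ne ∈ₘ Γ
      alive-cover []       _        b∈B cover with () ← cover b∈B
      alive-cover (a ∷ as) (p ∷ ps) _   cover =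
        alive-⊆ (λ x∈B → ∈-span a as (cover x∈B)) (alive-span as p ps)

      alive-intro : ∀ {ne} → (∀ {a} → a ∈ B → alive₁ a ∈ₘ Γ) → alive B ne ∈ₘ Γ
      alive-intro {B} {ne} f = alive-cover (members B) (All-members f) (proj₂ (toWitness ne)) ∈-members

      deadS-intro : (∀ {a} → a ∈ B → dead a ∈ₘ Γ) → deadS B ∈ₘ Γ
      deadS-intro f = ∈ₘ-⋀⁺ Γ (All.map⁺ (All-members f))

      deadS-elim : deadS B ∈ₘ Γ → a ∈ B → dead a ∈ₘ Γ
      deadS-elim p a∈B = All.lookup (∈ₘ-⋀⁻ Γ _ p) (∈-map⁺ dead (∈-members a∈B))

      ∈ₘ-⋁ : ∀ φs → ⋁ φs ∈ₘ Γ → ¬ All (λ φ → ¬ φ ∈ₘ Γ) φs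
      ∈ₘ-⋁ []       p _          = ⊥∉ₘ Γ p
      ∈ₘ-⋁ (φ ∷ φs) p (φ∉ ∷ φs∉) =
        ∈ₘ-⋁ φs (∈ₘ-sem₂ Γ (λ _ a b → ⊨-¬¬ (⊨-¬⁺ (λ t → ⊨-¬⁻ a (⊨-∧⁺ b t)))) p (∉ₘ⇒¬∈ₘ Γ φ∉)) φs∉

      some-alive : ¬ (∀ a → ¬ alive₁ a ∈ₘ Γ)
      some-alive none = ∈ₘ-⋁ _ (∈ₘ-theorem Γ (axSC some)) (All.map⁺ (All.tabulate (λ {a} _ → none a)))

  module Unravelling (L : System) where
    open MaximalConsistent L
    open CanonicalModel L
    open Unravel L

    private variable
      a : Agent
      B C : Subset n
      c h x y : History

    infix 4 _≼_
    data _≼_ : History → History → Set₁ where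
      ≼-refl : h ≼ h
      ≼-ext  : ∀ {B Γ r} → c ≼ h → c ≼ ext h B Γ r

    depth : History → ℕ
    depth (root _)      = zero
    depth (ext h _ _ _) = suc (depth h)

    ≼⇒depth≤ : c ≼ h → depth c ≤ depth h
    ≼⇒depth≤ ≼-refl    = ≤-refl
    ≼⇒depth≤ (≼-ext p) = m≤n⇒m≤1+n (≼⇒depth≤ p)

    ≼-ext⁻ : ∀ {B Γ r} → c ≼ ext h B Γ r → c ≡ ext h B Γ r ⊎ c ≼ h
    ≼-ext⁻ ≼-refl    = inj₁ refl
    ≼-ext⁻ (≼-ext p) = inj₂ p

    ext⋠ : ∀ {B Γ r} → ext h B Γ r ≼ x → ¬ x ≼ h
    ext⋠ p q = 1+n≰n (≤-trans (≼⇒depth≤ p) (≼⇒depth≤ q))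

    label : History → Subset n
    label (root _)      = Subset.⊥
    label (ext _ B _ _) = B

    -- The edge entering c lies on the tree path between x and y.
    Separates : History → History → History → Set₁
    Separates c x y = (c ≼ x × ¬ c ≼ y) ⊎ (¬ c ≼ x × c ≼ y)

    Separates-sym : Separates c x y → Separates c y x
    Separates-sym (inj₁ (p , q)) = inj₂ (q , p)
    Separates-sym (inj₂ (p , q)) = inj₁ (q , p)

    step-separates : Step a x y → Separates c x y → a ∈ label c
    step-separates (step a∈B) (inj₁ (c≼x , c⋠y)) = ⊥-elim (c⋠y (≼-ext c≼x))
    step-separates (step a∈B) (inj₂ (c⋠x , c≼y)) with ≼-ext⁻ c≼y
    ... | inj₁ refl = a∈B
    ... | inj₂ c≼x  = ⊥-elim (c⋠x c≼x)

    edge-separates : SymClosure (Step a) x y → Separates c x y → a ∈ label c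
    edge-separates (fwd s) sep = step-separates s sep
    edge-separates (bwd s) sep = step-separates s (Separates-sym sep)

    Connected : Subset n → History → History → Set₁
    Connected B x y = ∀ c → Separates c x y → B ⊆ label c

    Separates-split : ∀ {z} → Dec (c ≼ z) → Separates c x y → Separates c x z ⊎ Separates c z y
    Separates-split (yes c≼z) (inj₁ (c≼x , c⋠y)) = inj₂ (inj₁ (c≼z , c⋠y))
    Separates-split (no c⋠z)  (inj₁ (c≼x , c⋠y)) = inj₁ (inj₁ (c≼x , c⋠z))
    Separates-split (yes c≼z) (inj₂ (c⋠x , c≼y)) = inj₁ (inj₂ (c⋠x , c≼z))
    Separates-split (no c⋠z)  (inj₂ (c⋠x , c≼y)) = inj₂ (inj₂ (c⋠z , c≼y))

    ⋠-ext : ∀ {z B Γ r} → ¬ ext h B Γ r ≼ z → c ≼ z → ¬ c ≼ h → ¬ c ≼ ext h B Γ r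
    ⋠-ext e⋠z c≼z c⋠h c≼e with ≼-ext⁻ c≼e
    ... | inj₁ refl = e⋠z c≼z
    ... | inj₂ c≼h  = c⋠h c≼h

    connected-⇓ : ∀ {B′ Γ r} → x ≼ h → Connected B x (ext h B′ Γ r) → Connected B x h × B ⊆ B′
    connected-⇓ {x} {h} {B} x≼h conn = conn′ , conn _ (inj₂ (e⋠x , ≼-refl))
      where
      e⋠x = λ e≼x → ext⋠ e≼x x≼h
      conn′ : Connected B x h
      conn′ c (inj₁ (c≼x , c⋠h)) = conn c (inj₁ (c≼x , ⋠-ext e⋠x c≼x c⋠h))
      conn′ c (inj₂ (c⋠x , c≼h)) = conn c (inj₂ (c⋠x , ≼-ext c≼h))

    connected-⇑ : ∀ {C Γ r} → ¬ ext h C Γ r ≼ y → Connected B (ext h C Γ r) y → Connected B h y × B ⊆ C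
    connected-⇑ {h} {y} {B} e⋠y conn = conn′ , conn _ (inj₁ (≼-refl , e⋠y))
      where
      conn′ : Connected B h y
      conn′ c (inj₁ (c≼h , c⋠y)) = conn c (inj₁ (≼-ext c≼h , c⋠y))
      conn′ c (inj₂ (c⋠h , c≼y)) = conn c (inj₂ (⋠-ext e⋠y c≼y c⋠h , c≼y))

    D-transport-≼ : ∀ {ne χ} → x ≼ y → Connected B x y → D B ne χ ∈ₘ lastW x → D B ne χ ∈ₘ lastW y
    D-transport-≼ ≼-refl _ p = p
    D-transport-≼ (≼-ext {h = h} {Γ = Γ} {r} x≼h) conn p with connected-⇓ x≼h conn
    ... | conn′ , B⊆B′ = ∼c-transport {Γ = lastW h} {Δ = Γ} r B⊆B′ (D-transport-≼ x≼h conn′ p)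

    edge⇒alive : SymClosure (Step a) h y → alive₁ a ∈ₘ lastW h
    edge⇒alive {h = h} (fwd (step {Γ = Γ} {r} a∈B)) = ∼c-alive {Γ = lastW h} {Δ = Γ} r a∈B
    edge⇒alive (bwd (step {h = y} {Γ = Γ} {r} a∈B)) =
      ∼c-alive {Γ = Γ} {Δ = lastW y} (∼c-sym {Γ = lastW y} {Δ = Γ} r) a∈B

    live⇒alive : liveU h a → alive₁ a ∈ₘ lastW h
    live⇒alive [ e ]   = edge⇒alive e
    live⇒alive (e ∷ _) = edge⇒alive e

    alive⇒live : alive₁ a ∈ₘ lastW h → liveU h a
    alive⇒live {a} {h} p with alive⇒∼c (lastW h) p
    ... | Δ , r = fwd (step {h = h} {Γ = Δ} {r = r} (x∈⁅x⁆ a)) ∷ [ bwd (step (x∈⁅x⁆ a)) ]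

    ext-live⇔ : ∀ {B Δ r} → deadS (∁ B) ∈ₘ Δ → ∀ a → liveU (ext h B Δ r) a ⇔ a ∈ B
    ext-live⇔ {h} {B} {Δ} {r} ∁B-dead a = mk⇔ live⇒∈B ∈B⇒live
      where
      live⇒∈B : liveU (ext h B Δ r) a → a ∈ B
      live⇒∈B a-live = decidable-stable (a ∈? B) λ a∉B →
        ∈ₘ-¬ Δ (deadS-elim Δ ∁B-dead (x∉p⇒x∈∁p a∉B)) (live⇒alive a-live)
      ∈B⇒live : a ∈ B → liveU (ext h B Δ r) a
      ∈B⇒live a∈B = bwd (step {h = h} {Γ = Δ} {r = r} a∈B) ∷ [ fwd (step a∈B) ]

    quotient-partialEpistemic : IsPartialEpistemic (Quotient L)
    quotient-partialEpistemic a = Plus.symmetric _ (Sym.symmetric (Step a)) , Plus.transitive _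

    module _ (lem : ExcludedMiddle (lsuc 0ℓ)) where

      -- A walk has to cross the separating edge, and only agents of its label cross it.
      walk-separates : x ∼u[ a ] y → Separates c x y → a ∈ label c
      walk-separates [ e ] sep = edge-separates e sep
      walk-separates (e ∷ w) sep with Separates-split lem sep
      ... | inj₁ sep′ = edge-separates e sep′
      ... | inj₂ sep′ = walk-separates w sep′

      walks⇒connected : (∀ {a} → a ∈ B → x ∼u[ a ] y) → Connected B x y
      walks⇒connected walks c sep a∈B = walk-separates (walks a∈B) sep

      D-transport : ∀ {ne χ} → Connected B x y → D B ne χ ∈ₘ lastW x → D B ne χ ∈ₘ lastW y
      D-transport {x = x} {y = y} conn p with lem {x ≼ y}
      ... | yes x≼y = D-transport-≼ x≼y conn p
      D-transport {x = root _} {ne = ne} conn p | no x⋠y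
        with b , b∈B ← toWitness ne = ⊥-elim (∉⊥ (conn _ (inj₁ (≼-refl , x⋠y)) b∈B))
      D-transport {x = ext h C Γ r} conn p | no x⋠y with connected-⇑ x⋠y conn
      ... | conn′ , B⊆C =
        D-transport conn′ (∼c-transport {Γ = Γ} {Δ = lastW h} (∼c-sym {Γ = lastW h} {Δ = Γ} r) B⊆C p)

  module Minimality (lem : ExcludedMiddle (lsuc 0ℓ)) where
    open MaximalConsistent SCmin
    open CanonicalModel SCmin
    open Unravel SCmin
    open Unravelling SCmin
    open Classical lem

    aliveSet : History → Subset n
    aliveSet h = subset (λ a → alive₁ a ∈ₘ lastW h)

    aliveSet-NE : ∀ h → NE (aliveSet h)
    aliveSet-NE h = NE-intro (decidable-stable (nonempty? (aliveSet h))
                      (λ empty → some-alive (lastW h) (λ a a-alive → empty (a , ∈-subset⁺ a-alive))))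

    D-∁aliveSet-dead : ∀ h → NE (∁ (aliveSet h)) →
                       D (aliveSet h) (aliveSet-NE h) (deadS (∁ (aliveSet h))) ∈ₘ lastW h
    D-∁aliveSet-dead h ne∁ = ∈ₘ-⊢mp Γ (axX (axMin (aliveSet h) (aliveSet-NE h) ne∁))
                               (∈ₘ-∧ Γ (alive-intro Γ ∈-subset⁻) (deadS-intro Γ ∁aliveSet⇒dead))
      where
      Γ = lastW h
      ∁aliveSet⇒dead : ∀ {a} → a ∈ ∁ (aliveSet h) → dead a ∈ₘ Γ
      ∁aliveSet⇒dead a∈∁ = ∉ₘ-¬⇒∈ₘ Γ (λ a-alive → x∈∁p⇒x∉p a∈∁ (∈-subset⁺ a-alive))

    connected-live-⊇ : ∀ {h h′ b} → (∀ a → liveU h a → liveU h′ a) → (∀ a → liveU h a → h ∼u[ a ] h′) →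
                       liveU h′ b → liveU h b
    connected-live-⊇ {h} {h′} {b} live⊆ connected b-live′ = alive⇒live (∈ₘ-stable (lastW h) λ b-dead →
      ∈ₘ-¬ Γ′ (deadS-elim Γ′ (∁B-dead′ (ne∁ b-dead)) (b∈∁B b-dead)) (live⇒alive b-live′))
      where
      Γ′ = lastW h′
      B  = aliveSet h
      b∈∁B : ¬ alive₁ b ∈ₘ lastW h → b ∈ ∁ B
      b∈∁B b-dead = x∉p⇒x∈∁p (λ b∈B → b-dead (∈-subset⁻ b∈B))
      ne∁ : ¬ alive₁ b ∈ₘ lastW h → NE (∁ B)
      ne∁ b-dead = NE-intro (b , b∈∁B b-dead)
      B-connected : Connected B h h′
      B-connected = walks⇒connected lem (λ a∈B → connected _ (alive⇒live (∈-subset⁻ a∈B)))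
      B-alive′ : alive B (aliveSet-NE h) ∈ₘ Γ′
      B-alive′ = alive-intro Γ′ (λ a∈B → live⇒alive (live⊆ _ (alive⇒live (∈-subset⁻ a∈B))))
      ∁B-dead′ : NE (∁ B) → deadS (∁ B) ∈ₘ Γ′
      ∁B-dead′ ne∁ = alive⇒D-reflexive Γ′ B-alive′ (D-transport lem B-connected (D-∁aliveSet-dead h ne∁))

    quotient-minimal : IsMinimal (Quotient SCmin)
    quotient-minimal h h′ (live⊆ , live⊉) =
      ¬⊆⇒∃∖ (λ connected → live⊉ (λ _ → connected-live-⊇ live⊆ connected))

  module Maximality (lem : ExcludedMiddle (lsuc 0ℓ)) where
    open MaximalConsistent SCmax
    open CanonicalModel SCmax
    open Unravel SCmax
    open Unravelling SCmax
    open Classical lem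

    restriction : ∀ h′ {B} → NE B → NE (∁ B) → (∀ a → a ∈ B → liveU h′ a) →
                  ∃[ h ] ((∀ a → liveU h a ⇔ a ∈ B) × (∀ a → a ∈ B → h ∼u[ a ] h′))
    restriction h′ {B} ne ne∁ B⊆live with existence (lastW h′) (deadS (∁ B)) ◇∁B-dead
      where
      ◇∁B-dead : ¬' D B ne (¬' deadS (∁ B)) ∈ₘ lastW h′
      ◇∁B-dead = ∈ₘ-⊢mp (lastW h′) (axX (axMax B ne ne∁))
                   (alive-intro (lastW h′) (λ {a} a∈B → live⇒alive (B⊆live a a∈B)))
    ... | Δ , r , ∁B-dead = ext h′ B Δ r , ext-live⇔ ∁B-dead , λ a a∈B → [ bwd (step a∈B) ]

    quotient-maximal : IsMaximal (Quotient SCmax)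
    quotient-maximal h′ B B-nonempty B⊆live live⊈B
      with b , _ , b∉B ← ¬⊆⇒∃∖ {Q = λ a → Lift _ (a ∈ B)} (λ ⊆B → live⊈B (λ a l → lower (⊆B a l))) =
      restriction h′ (NE-intro B-nonempty) (NE-intro (b , x∉p⇒x∈∁p (b∉B ∘ lift))) B⊆live

proposition49 : (lem : ExcludedMiddle (Level.suc Level.zero)) → (n : ℕ) →
    let open Logic n in
    (IsPartialEpistemic (Quotient SCmin) × IsMinimal (Quotient SCmin))
    × (IsPartialEpistemic (Quotient SCmax) × IsMaximal (Quotient SCmax))
proposition49 lem n =
    (Unravelling.quotient-partialEpistemic n SCmin , Minimality.quotient-minimal n lem)
  , (Unravelling.quotient-partialEpistemic n SCmax , Maximality.quotient-maximal n lem)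
  where open Logic n using (SCmin; SCmax)
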